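{- Let $r\ge 2$ be an integer and let $\mathcal{D}$ be the infinite lattice path defined below, with vertices $w_0,w_1,w_2,\dots$ and northwest corners $v_0,v_1,v_2,\dots$. For every $i\ge 0$, if $w_i$ has coordinates $(x,y)$, then $v_i=\big((r-1)x+(r-2)y,\; x+y\big)$.
   Context: Define integers $c_1=0$, $c_2=1$, $c_n=rc_{n-1}-c_{n-2}$ for $n\ge 3$. For coprime nonnegative integers $a,b$, the maximal Dyck path $\mathcal{P}(a,b)$ is the lattice path from $(0,0)$ to $(a,b)$ using unit north and east steps that never passes strictly above the line segment from $(0,0)$ to $(a,b)$ and is, among all such paths, the one closest to this segment (its height at every vertex is maximal). For $n\ge 3$ let $\mathcal{D}_n=\mathcal{P}(c_{n-1}-c_{n-2},c_{n-2})$. Each $\mathcal{D}_{n}$ is a prefix of $\mathcal{D}_{n+1}$, and $\mathcal{D}$ denotes the infinite path $\bigcup_{n\ge3}\mathcal{D}_n$ starting at $(0,0)$. Its vertices are labeled $w_0=(0,0),w_1,w_2,\dots$ in order along the path (so $w_i$ is reached after $i$ steps). A northwest corner is a vertex that is the leftmost vertex of the path at its height; the northwest corners are labeled $v_0=(0,0),v_1,v_2,\dots$ in order of increasing height (so $v_j$ has height $j$). -}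

module Defs where

open import Data.Nat using (ℕ; zero; suc; _+_; _*_; _∸_; _≤_; _<_)
open import Data.Product using (_×_; _,_; proj₁; proj₂; ∃)
open import Data.Sum using (_⊎_)
open import Relation.Binary.PropositionalEquality using (_≡_)

Point : Set
Point = ℕ × ℕ

-- Index 0 is unused (set to 0). For r ≥ 2 the sequence is nondecreasing and
-- r c_{n-1} ≥ c_{n-2}, so truncated subtraction ∸ is exact subtraction.
c : ℕ → ℕ → ℕ
c r zero = 0
c r (suc zero) = 0
c r (suc (suc zero)) = 1
c r (suc (suc (suc n))) = r * c r (suc (suc n)) ∸ c r (suc n)

Step : Point → Point → Set
Step (x , y) q = (q ≡ (suc x , y)) ⊎ (q ≡ (x , suc y))

-- A lattice path with unit north/east steps from (0,0) to (a,b), given by its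
-- vertices p 0, p 1, …, p (a + b) (values of p beyond a + b are irrelevant).
LatticePath : ℕ → ℕ → (ℕ → Point) → Set
LatticePath a b p =
  (p 0 ≡ (0 , 0)) ×
  (∀ k → k < a + b → Step (p k) (p (suc k))) ×
  (p (a + b) ≡ (a , b))

NotAbove : ℕ → ℕ → Point → Set
NotAbove a b (x , y) = y * a ≤ b * x

DyckPath : ℕ → ℕ → (ℕ → Point) → Set
DyckPath a b p = LatticePath a b p × (∀ k → k ≤ a + b → NotAbove a b (p k))

IsMaxDyck : ℕ → ℕ → (ℕ → Point) → Set
IsMaxDyck a b p =
  DyckPath a b p ×
  (∀ q → DyckPath a b q → ∀ k → k ≤ a + b → proj₂ (q k) ≤ proj₂ (p k))

-- The infinite path D (vertices w 0, w 1, …) for parameter r: for every n ≥ 3,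
-- its initial segment is the maximal Dyck path D_n = P(c_{n-1} - c_{n-2}, c_{n-2}).
IsD : ℕ → (ℕ → Point) → Set
IsD r w = ∀ n → 3 ≤ n → IsMaxDyck (c r (n ∸ 1) ∸ c r (n ∸ 2)) (c r (n ∸ 2)) w

IsNWCorner : (ℕ → Point) → ℕ → Point → Set
IsNWCorner w j p =
  (proj₂ p ≡ j) ×
  (∃ λ k → w k ≡ p) ×
  (∀ k → proj₂ (w k) ≡ j → proj₁ p ≤ proj₁ (w k))

-- On stage m of D the height after k ≤ N steps is ⌊B k / N⌋ (A, B, N = c_{m+1}, c_{m+2}, c_{m+3}),
-- since a maximal Dyck path is the greedy path below the line. Cassini's identity B² = A N + 1
-- turns ⌊B i / N⌋ = y into ⌊A i / B⌋ = y. For w_i = (x, y) put K = (r-1)x + (r-2)y + i; the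
-- recurrence N + A = r B gives B K = i N + (A i - y B) with 0 ≤ A i - y B < B, so K is the first
-- step at which D reaches height i, and w_K = ((r-1)x + (r-2)y, i).
module Submission where

open import Defs
open import Data.Nat
open import Data.Nat.Properties
open import Data.Nat.Tactic.RingSolver using (solve; solve-∀)
open import Data.List using (_∷_; [])
open import Data.Product using (_×_; _,_; proj₁; proj₂)
open import Data.Sum using (_⊎_; inj₁; inj₂)
open import Relation.Binary.PropositionalEquality
open import Relation.Nullary using (yes; no)
open import Algebra.Properties.CommutativeSemigroup *-commutativeSemigroup using (x∙yz≈z∙yx)

infix 4 ⌊_/_⌋≡_

record ⌊_/_⌋≡_ (m n q : ℕ) : Set where
  constructor _,_
  field
    lower : q * n ≤ m
    upper : m < suc q * n

open ⌊_/_⌋≡_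

⌊/⌋≡-unique : ∀ {m n q q′} → ⌊ m / n ⌋≡ q → ⌊ m / n ⌋≡ q′ → q ≡ q′
⌊/⌋≡-unique {n = n} (qn≤m , m<[1+q]n) (q′n≤m , m<[1+q′]n) =
  ≤-antisym (below qn≤m m<[1+q′]n) (below q′n≤m m<[1+q]n)
  where
  below : ∀ {m s t} → s * n ≤ m → m < suc t * n → s ≤ t
  below {s = s} {t} sn≤m m<[1+t]n = ≤-pred (*-cancelʳ-< n s (suc t) (≤-<-trans sn≤m m<[1+t]n))

⌊m*n/n⌋≡m : ∀ m n .{{_ : NonZero n}} → ⌊ m * n / n ⌋≡ m
⌊m*n/n⌋≡m m n = ≤-refl , *-monoˡ-< n (n<1+n m)

⌊/⌋≡-remainder : ∀ {s b y} t u → ⌊ s / b ⌋≡ y → u + y * b ≡ t + s → t ≤ u × u < t + b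
⌊/⌋≡-remainder {s} {b} {y} t u (yb≤s , s<[1+y]b) u+yb≡t+s =
  +-cancelʳ-≤ (y * b) t u (≤-trans (+-monoʳ-≤ t yb≤s) (≤-reflexive (sym u+yb≡t+s))) ,
  +-cancelʳ-< (y * b) u (t + b) (begin-strict
    u + y * b       ≡⟨ u+yb≡t+s ⟩
    t + s           <⟨ +-monoʳ-< t s<[1+y]b ⟩
    t + (b + y * b) ≡⟨ sym (+-assoc t b (y * b)) ⟩
    t + b + y * b   ∎)
  where open ≤-Reasoning

-- b/n - a/b = 1/(n b), so for i < n the quotients b i / n and a i / b differ by less than 1/b
-- and therefore have the same floor.
⌊/⌋≡-cassini : ∀ {a b n i y} .{{_ : NonZero b}} → b * b ≡ a * n + 1 → i < n →
               ⌊ b * i / n ⌋≡ y → ⌊ a * i / b ⌋≡ y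
⌊/⌋≡-cassini {a} {b} {n} {i} {y} b²≡an+1 i<n (yn≤bi , bi<[1+y]n) =
  ≤-pred (*-cancelˡ-< n (y * b) (suc (a * i)) (begin-strict
    n * (y * b)     ≡⟨ solve (n ∷ y ∷ b ∷ []) ⟩
    b * (y * n)     ≤⟨ *-monoʳ-≤ b yn≤bi ⟩
    b * (b * i)     ≡⟨ b[bi]≡n[ai]+i ⟩
    n * (a * i) + i <⟨ +-monoʳ-< (n * (a * i)) i<n ⟩
    n * (a * i) + n ≡⟨ solve (n ∷ a ∷ i ∷ []) ⟩
    n * suc (a * i) ∎)) ,
  *-cancelˡ-< n (a * i) (suc y * b) (begin-strict
    n * (a * i)     ≤⟨ m≤m+n (n * (a * i)) i ⟩
    n * (a * i) + i ≡⟨ sym b[bi]≡n[ai]+i ⟩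
    b * (b * i)     <⟨ *-monoʳ-< b bi<[1+y]n ⟩
    b * (suc y * n) ≡⟨ solve (b ∷ y ∷ n ∷ []) ⟩
    n * (suc y * b) ∎)
  where
  open ≤-Reasoning
  b[bi]≡n[ai]+i : b * (b * i) ≡ n * (a * i) + i
  b[bi]≡n[ai]+i = begin-equality
    b * (b * i)       ≡⟨ sym (*-assoc b b i) ⟩
    b * b * i         ≡⟨ cong (_* i) b²≡an+1 ⟩
    (a * n + 1) * i   ≡⟨ solve (a ∷ n ∷ i ∷ []) ⟩
    n * (a * i) + i   ∎

level : Point → ℕ
level (x , y) = x + y

Step-level : ∀ {u v} → Step u v → level v ≡ suc (level u)
Step-level {x , y} (inj₁ refl) = refl
Step-level {x , y} (inj₂ refl) = +-suc x y

LatticePath-level : ∀ {a b p} → LatticePath a b p → ∀ k → k ≤ a + b → level (p k) ≡ k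
LatticePath-level {a} {b} {p} (p0≡0 , steps , _) = go
  where
  go : ∀ k → k ≤ a + b → level (p k) ≡ k
  go zero    _      = cong level p0≡0
  go (suc k) 1+k≤n = trans (Step-level (steps k 1+k≤n)) (cong suc (go k (<⇒≤ 1+k≤n)))

NotAbove⇒heightBound : ∀ a b x y → NotAbove a b (x , y) → y * (a + b) ≤ b * (x + y)
NotAbove⇒heightBound a b x y ya≤bx = begin
  y * (a + b)   ≡⟨ *-distribˡ-+ y a b ⟩
  y * a + y * b ≤⟨ +-mono-≤ ya≤bx (≤-reflexive (*-comm y b)) ⟩
  b * x + b * y ≡⟨ sym (*-distribˡ-+ b x y) ⟩
  b * (x + y)   ∎
  where open ≤-Reasoning

heightBound⇒NotAbove : ∀ a b x y → y * (a + b) ≤ b * (x + y) → NotAbove a b (x , y)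
heightBound⇒NotAbove a b x y bound = +-cancelʳ-≤ (y * b) (y * a) (b * x) (begin
  y * a + y * b ≡⟨ sym (*-distribˡ-+ y a b) ⟩
  y * (a + b)   ≤⟨ bound ⟩
  b * (x + y)   ≡⟨ *-distribˡ-+ b x y ⟩
  b * x + b * y ≡⟨ cong (b * x +_) (*-comm b y) ⟩
  b * x + y * b ∎)
  where open ≤-Reasoning

module FloorPath (a b : ℕ) .{{_ : NonZero (a + b)}} where

  floorHeight : ℕ → ℕ
  floorHeight zero = 0
  floorHeight (suc k) with suc (floorHeight k) * (a + b) ≤? b * suc k
  ... | yes _ = suc (floorHeight k)
  ... | no  _ = floorHeight k

  floorHeight-⌊/⌋ : ∀ k → ⌊ b * k / (a + b) ⌋≡ floorHeight k
  floorHeight-⌊/⌋ zero = z≤n , subst (_< suc 0 * (a + b)) (sym (*-zeroʳ b)) (*-monoˡ-< (a + b) (n<1+n 0))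
  floorHeight-⌊/⌋ (suc k) with suc (floorHeight k) * (a + b) ≤? b * suc k | floorHeight-⌊/⌋ k
  ... | yes north | (_ , bk<[1+h]n) = north , (begin-strict
    b * suc k                               ≡⟨ *-suc b k ⟩
    b + b * k                               <⟨ +-mono-≤-< (m≤n+m b a) bk<[1+h]n ⟩
    a + b + suc (floorHeight k) * (a + b)   ∎)
    where open ≤-Reasoning
  ... | no  east  | (hn≤bk , _) = ≤-trans hn≤bk (*-monoʳ-≤ b (n≤1+n k)) , ≰⇒> east

  floorHeight-step : ∀ k → (floorHeight (suc k) ≡ floorHeight k) ⊎ (floorHeight (suc k) ≡ suc (floorHeight k))
  floorHeight-step k with suc (floorHeight k) * (a + b) ≤? b * suc k
  ... | yes _ = inj₂ refl
  ... | no  _ = inj₁ refl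

  floorHeight≤ : ∀ k → floorHeight k ≤ k
  floorHeight≤ zero = z≤n
  floorHeight≤ (suc k) with floorHeight-step k
  ... | inj₁ same  = subst (_≤ suc k) (sym same) (m≤n⇒m≤1+n (floorHeight≤ k))
  ... | inj₂ north = subst (_≤ suc k) (sym north) (s≤s (floorHeight≤ k))

  floorPath : ℕ → Point
  floorPath k = (k ∸ floorHeight k , floorHeight k)

  floorPath-step : ∀ k → Step (floorPath k) (floorPath (suc k))
  floorPath-step k with floorHeight-step k
  ... | inj₁ same  rewrite same  = inj₁ (cong (_, floorHeight k) (+-∸-assoc 1 (floorHeight≤ k)))
  ... | inj₂ north rewrite north = inj₂ refl

  floorPath-isDyck : DyckPath a b floorPath
  floorPath-isDyck = (refl , (λ k _ → floorPath-step k) , end) , notAbove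
    where
    floorHeight[a+b]≡b : floorHeight (a + b) ≡ b
    floorHeight[a+b]≡b = ⌊/⌋≡-unique (floorHeight-⌊/⌋ (a + b)) (⌊m*n/n⌋≡m b (a + b))
    end : floorPath (a + b) ≡ (a , b)
    end rewrite floorHeight[a+b]≡b = cong (_, b) (m+n∸n≡m a b)
    notAbove : ∀ k → k ≤ a + b → NotAbove a b (floorPath k)
    notAbove k _ = heightBound⇒NotAbove a b (k ∸ floorHeight k) (floorHeight k)
      (subst (λ l → floorHeight k * (a + b) ≤ b * l) (sym (m∸n+n≡m (floorHeight≤ k)))
             (lower (floorHeight-⌊/⌋ k)))

maxDyck-height : ∀ {a b p} .{{_ : NonZero (a + b)}} → IsMaxDyck a b p →
                 ∀ k → k ≤ a + b → ⌊ b * k / (a + b) ⌋≡ proj₂ (p k)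
maxDyck-height {a} {b} {p} ((path , notAbove) , maximal) k k≤a+b =
  subst (λ l → proj₂ (p k) * (a + b) ≤ b * l) (LatticePath-level path k k≤a+b)
        (NotAbove⇒heightBound a b (proj₁ (p k)) (proj₂ (p k)) (notAbove k k≤a+b)) ,
  <-≤-trans (upper (floorHeight-⌊/⌋ k))
            (*-monoˡ-≤ (a + b) (s≤s (maximal floorPath floorPath-isDyck k k≤a+b)))
  where open FloorPath a b

module Sequence (r′ : ℕ) where

  r : ℕ
  r = 2 + r′

  C : ℕ → ℕ
  C = c r

  c-increasing : ∀ m → C (1 + m) < C (2 + m)
  c-increasing zero    = z<s
  c-increasing (suc m) = m+n≤o⇒m≤o∸n (suc q) (begin
    suc q + p ≡⟨ sym (+-suc q p) ⟩
    q + suc p ≤⟨ +-monoʳ-≤ q (c-increasing m) ⟩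
    q + q     ≤⟨ +-monoʳ-≤ q (m≤m+n q (r′ * q)) ⟩
    r * q     ∎)
    where
    open ≤-Reasoning
    p = C (1 + m)
    q = C (2 + m)

  c-recurrence : ∀ m → C (3 + m) + C (1 + m) ≡ r * C (2 + m)
  c-recurrence m = m∸n+n≡m (≤-trans (<⇒≤ (c-increasing m)) (m≤m+n (C (2 + m)) _))

  n<c[2+n] : ∀ n → n < C (2 + n)
  n<c[2+n] zero    = z<s
  n<c[2+n] (suc n) = ≤-trans (s≤s (n<c[2+n] n)) (c-increasing (suc n))

  c-cassini : ∀ m → C (2 + m) * C (2 + m) ≡ C (1 + m) * C (3 + m) + 1
  c-cassini zero    = refl
  c-cassini (suc m) = +-cancelʳ-≡ (p * s) (s * s) (q * t + 1) (begin
    s * s + p * s       ≡⟨ cong (s * s +_) (*-comm p s) ⟩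
    s * s + s * p       ≡⟨ sym (*-distribˡ-+ s s p) ⟩
    s * (s + p)         ≡⟨ cong (s *_) (c-recurrence m) ⟩
    s * (r * q)         ≡⟨ x∙yz≈z∙yx s r q ⟩
    q * (r * s)         ≡⟨ cong (q *_) (sym (c-recurrence (suc m))) ⟩
    q * (t + q)         ≡⟨ *-distribˡ-+ q t q ⟩
    q * t + q * q       ≡⟨ cong (q * t +_) (c-cassini m) ⟩
    q * t + (p * s + 1) ≡⟨ cong (q * t +_) (+-comm (p * s) 1) ⟩
    q * t + (1 + p * s) ≡⟨ sym (+-assoc (q * t) 1 (p * s)) ⟩
    q * t + 1 + p * s   ∎)
    where
    open ≡-Reasoning
    p = C (1 + m)
    q = C (2 + m)
    s = C (3 + m)
    t = C (4 + m)

-- Stage m of D is the maximal Dyck path D_{4+m}, ending at level C (3 + m) with height C (2 + m).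
module PathD (r′ : ℕ) (w : ℕ → Point) (isD : IsD (2 + r′) w) where
  open Sequence r′

  n<c[3+n] : ∀ n → n < C (3 + n)
  n<c[3+n] n = <-trans (n<c[2+n] n) (c-increasing (suc n))

  stage-end : ∀ m → C (3 + m) ∸ C (2 + m) + C (2 + m) ≡ C (3 + m)
  stage-end m = m∸n+n≡m (<⇒≤ (c-increasing (suc m)))

  level-w : ∀ k → level (w k) ≡ k
  level-w k = LatticePath-level (proj₁ (proj₁ (isD (4 + k) (s≤s (s≤s (s≤s z≤n)))))) k
                (subst (k ≤_) (sym (stage-end k)) (<⇒≤ (n<c[3+n] k)))

  height-w : ∀ m k → k ≤ C (3 + m) → ⌊ C (2 + m) * k / C (3 + m) ⌋≡ proj₂ (w k)
  height-w m k k≤N = subst (λ n → ⌊ C (2 + m) * k / n ⌋≡ proj₂ (w k)) (stage-end m)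
    (maxDyck-height (isD (4 + m) (s≤s (s≤s (s≤s z≤n)))) k (subst (k ≤_) (sym (stage-end m)) k≤N))
    where
    instance
      _ : NonZero (C (3 + m) ∸ C (2 + m) + C (2 + m))
      _ = >-nonZero (subst (0 <_) (sym (stage-end m)) (≤-<-trans z≤n (n<c[3+n] m)))

  module Corner (i m : ℕ) (ri<N : r * i < C (3 + m)) where
    A : ℕ
    A = C (1 + m)
    B : ℕ
    B = C (2 + m)
    N : ℕ
    N = C (3 + m)
    x : ℕ
    x = proj₁ (w i)
    y : ℕ
    y = proj₂ (w i)
    X : ℕ
    X = suc r′ * x + r′ * y
    K : ℕ
    K = X + i

    instance
      _ : NonZero B
      _ = >-nonZero (≤-<-trans z≤n (n<c[2+n] m))

    x+y≡i : x + y ≡ i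
    x+y≡i = level-w i

    K+y≡r*i : K + y ≡ r * i
    K+y≡r*i = begin
      X + i + y       ≡⟨ cong (λ j → X + j + y) (sym x+y≡i) ⟩
      X + (x + y) + y ≡⟨ regroup r′ x y ⟩
      r * (x + y)     ≡⟨ cong (r *_) x+y≡i ⟩
      r * i           ∎
      where
      open ≡-Reasoning
      regroup : ∀ s u v → suc s * u + s * v + (u + v) + v ≡ (2 + s) * (u + v)
      regroup = solve-∀

    i<N : i < N
    i<N = ≤-<-trans (m≤m+n i (suc r′ * i)) ri<N

    K≤N : K ≤ N
    K≤N = ≤-trans (m≤m+n K y) (≤-trans (≤-reflexive K+y≡r*i) (<⇒≤ ri<N))

    ⌊A*i/B⌋≡y : ⌊ A * i / B ⌋≡ y
    ⌊A*i/B⌋≡y = ⌊/⌋≡-cassini {a = A} (c-cassini m) i<N (height-w m i (<⇒≤ i<N))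

    B*K+y*B : B * K + y * B ≡ i * N + A * i
    B*K+y*B = begin
      B * K + y * B   ≡⟨ cong (B * K +_) (*-comm y B) ⟩
      B * K + B * y   ≡⟨ sym (*-distribˡ-+ B K y) ⟩
      B * (K + y)     ≡⟨ cong (B *_) K+y≡r*i ⟩
      B * (r * i)     ≡⟨ sym (*-assoc B r i) ⟩
      B * r * i       ≡⟨ cong (_* i) (trans (*-comm B r) (sym (c-recurrence m))) ⟩
      (N + A) * i     ≡⟨ *-distribʳ-+ i N A ⟩
      N * i + A * i   ≡⟨ cong (_+ A * i) (*-comm N i) ⟩
      i * N + A * i   ∎
      where open ≡-Reasoning

    B*K-bounds : i * N ≤ B * K × B * K < i * N + B
    B*K-bounds = ⌊/⌋≡-remainder (i * N) (B * K) ⌊A*i/B⌋≡y B*K+y*B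

    height-K : proj₂ (w K) ≡ i
    height-K = ⌊/⌋≡-unique (height-w m K K≤N)
      (proj₁ B*K-bounds ,
       <-≤-trans (proj₂ B*K-bounds)
                 (≤-trans (+-monoʳ-≤ (i * N) (<⇒≤ (c-increasing (suc m)))) (≤-reflexive (+-comm (i * N) N))))

    w[K] : w K ≡ (X , x + y)
    w[K] = cong₂ _,_
      (+-cancelʳ-≡ i (proj₁ (w K)) X (trans (cong (proj₁ (w K) +_) (sym height-K)) (level-w K)))
      (trans height-K (sym x+y≡i))

    K-leftmost : ∀ k → k ≤ N → proj₂ (w k) ≡ i → K ≤ k
    K-leftmost k k≤N height-k≡i = ≮⇒≥ λ k<K → <⇒≱ (B*k<i*N k<K) (i*N≤B*k)
      where
      i*N≤B*k : i * N ≤ B * k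
      i*N≤B*k = subst (λ h → h * N ≤ B * k) height-k≡i (lower (height-w m k k≤N))
      B*k<i*N : k < K → B * k < i * N
      B*k<i*N k<K = +-cancelʳ-< B (B * k) (i * N) (begin-strict
        B * k + B ≡⟨ +-comm (B * k) B ⟩
        B + B * k ≡⟨ sym (*-suc B k) ⟩
        B * suc k ≤⟨ *-monoʳ-≤ B k<K ⟩
        B * K     <⟨ proj₂ B*K-bounds ⟩
        i * N + B ∎)
        where open ≤-Reasoning

    X-leftmost : ∀ k → k ≤ N → proj₂ (w k) ≡ i → X ≤ proj₁ (w k)
    X-leftmost k k≤N height-k≡i = +-cancelʳ-≤ i X (proj₁ (w k))
      (subst (X + i ≤_) (trans (sym (level-w k)) (cong (proj₁ (w k) +_) height-k≡i))
             (K-leftmost k k≤N height-k≡i))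

lemma4p5 : (r : ℕ) → 2 ≤ r → (w : ℕ → Point) → IsD r w →
    ∀ i → IsNWCorner w i
      ((r ∸ 1) * proj₁ (w i) + (r ∸ 2) * proj₂ (w i) , proj₁ (w i) + proj₂ (w i))
lemma4p5 (suc (suc r′)) (s≤s (s≤s z≤n)) w isD i = level-w i , (K , w[K]) , leftmost
  where
  open Sequence r′ using (r)
  open PathD r′ w isD
  open Corner i (r * i) (n<c[3+n] (r * i)) using (K; w[K])
  leftmost : ∀ k → proj₂ (w k) ≡ i → suc r′ * proj₁ (w i) + r′ * proj₂ (w i) ≤ proj₁ (w k)
  leftmost k = Corner.X-leftmost i m (≤-<-trans (m≤m+n (r * i) k) (n<c[3+n] m)) k
                 (≤-trans (m≤n+m k (r * i)) (<⇒≤ (n<c[3+n] m)))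
    where m = r * i + k
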